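{- Let $\alpha$ be a tautology of $\mathbf{M}^{\rightarrow}$. Then the size (height) of any proof of $\alpha$ in the sequent calculus $\mathbf{LMT}^{\rightarrow}$ generated by the strategy $\mathcal{S}$-$\mathbf{LMT}^{\rightarrow}$ is at most $|\alpha| \cdot 2^{|\alpha| + 1 + 2\log_2|\alpha|}$.
   Context: Formulas of $\mathbf{M}^{\rightarrow}$ are built from atoms using only $\rightarrow$; Kripke models $\langle U,\preceq,\mathcal{V}\rangle$ are as for intuitionistic logic (partial order, monotone valuation of atoms, $i\models\alpha\rightarrow\beta$ iff every $j\succeq i$ forcing $\alpha$ forces $\beta$); a tautology is true at every world of every model. $|\alpha|$ is the number of occurrences of atoms and connectives in $\alpha$. $\mathbf{LMT}^{\rightarrow}$ sequents have the form $\{\Delta'\},\Upsilon_1^{p_1},\dots,\Upsilon_n^{p_n},\Delta\Rightarrow[p_1,\dots,p_n],\varphi$, where $\varphi$ is a formula, $\Delta,\Upsilon_1,\dots,\Upsilon_n$ are multisets of formulas, $\Upsilon_i^{p_i}$ means the formulas of $\Upsilon_i$ carry the label $p_i$, $\Delta'$ is a set of formulas (the focused formulas; the braces are an annotation, not set brackets), and $p_1,\dots,p_n$ is a repetition-free sequence of atoms (the []-area). $\Delta^q$ denotes a copy of $\Delta$ with every formula labelled $q$; $\Upsilon_i$ without superscript denotes the formulas of $\Upsilon_i^{p_i}$ with labels removed. Write $\overline{\Upsilon}$ for $\Upsilon_1^{p_1},\dots,\Upsilon_n^{p_n}$ and $\bar p$ for $p_1,\dots,p_n$. In each rule $\Delta'\subseteq\Delta$.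 Rules: Axiom: $\{\Delta',q\},\overline{\Upsilon},\Delta\Rightarrow[\bar p],q$. Focus: from $\{\Delta',\alpha\},\overline{\Upsilon},\Delta,\alpha\Rightarrow[\bar p],\beta$ infer $\{\Delta'\},\overline{\Upsilon},\Delta,\alpha\Rightarrow[\bar p],\beta$. Restart: from $\{\},\Upsilon_1,\dots,\Upsilon_i,\Upsilon_{i+1}^{p_{i+1}},\dots,\Upsilon_n^{p_n},\Delta^q\Rightarrow[p_1,p_2,\dots,p_{i+1},\dots,p_n,q],p_i$ infer $\{\Delta'\},\Upsilon_1^{p_1},\dots,\Upsilon_n^{p_n},\Delta\Rightarrow[p_1,\dots,p_n],q$. $\rightarrow$-right: from $\{\Delta'\},\overline{\Upsilon},\Delta,\alpha\Rightarrow[\bar p],\beta$ infer $\{\Delta'\},\overline{\Upsilon},\Delta\Rightarrow[\bar p],\alpha\rightarrow\beta$. $\rightarrow$-left (context $(\alpha\rightarrow\beta,q)$): from $\{\alpha\rightarrow\beta,\Delta'\},\overline{\Upsilon},\Delta^q,\Delta\Rightarrow[\bar p,q],\alpha$ and $\{\alpha\rightarrow\beta,\Delta'\},\overline{\Upsilon},\Delta,\beta\Rightarrow[\bar p],q$ infer $\{\alpha\rightarrow\beta,\Delta'\},\overline{\Upsilon},\Delta\Rightarrow[\bar p],q$. A proof of $\alpha$ is a finite tree of rule instances with root $\{\}\Rightarrow[],\alpha$ all of whose leaves are axioms. Strategy $\mathcal{S}$-$\mathbf{LMT}^{\rightarrow}$ (bottom-up from $\{\}\Rightarrow[],\alpha$):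 for each goal (leaf) sequent, if it is an axiom the branch closes; otherwise apply the first applicable of: (1) $\rightarrow$-right if the formula on the right outside the []-area is not atomic; (2) focus on some formula of $\Delta$ not in $\Delta'$; (3) if all left formulas are focused, apply $\rightarrow$-left to the first $\alpha\in\Delta'$ whose context $(\alpha,q)$ ($q$ the atom on the right outside the []-area) has not been used in an $\rightarrow$-left application since the last restart on the branch; (4) apply restart with the leftmost atom of the []-area not chosen before in this branch. -}

module Defs where

open import Data.Nat using (ℕ; suc; _+_; _⊔_; _≟_)
open import Data.Product using (Σ; _×_; _,_; proj₁; proj₂)
open import Data.List using (List; []; _∷_; _++_; [_]; map; filter)
open import Data.List.Membership.Propositional using (_∈_; _∉_)
open import Data.List.Membership.DecPropositional _≟_ using (_∈?_)
open import Data.List.Relation.Unary.All using (All)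
open import Relation.Nullary using (¬_; yes; no)
open import Relation.Nullary.Decidable using (¬?)
open import Relation.Binary.PropositionalEquality using (_≡_)
open import Relation.Binary.Structures using (IsPartialOrder)

infixr 6 _⇒_
data Form : Set where
  atom : ℕ → Form
  _⇒_  : Form → Form → Form

size : Form → ℕ
size (atom _) = 1
size (α ⇒ β)  = suc (size α + size β)

record Model : Set₁ where
  field
    W      : Set
    _≼_    : W → W → Set
    isPO   : IsPartialOrder _≡_ _≼_
    V      : W → ℕ → Set
    mono   : ∀ {i j p} → i ≼ j → V i p → V j p

open Model public

_⊩_at_ : (M : Model) → Form → W M → Set
M ⊩ atom p at i  = V M i p
M ⊩ (α ⇒ β) at i = ∀ j → _≼_ M i j → M ⊩ α at j → M ⊩ β at j

Tautology : Form → Set₁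
Tautology α = (M : Model) (i : W M) → M ⊩ α at i

-- LMT→ sequents
--   {focused}, labelled, ctx ⇒ [area], goal
-- labelled : the formulas of Υ₁^{p₁},…,Υₙ^{pₙ} as (formula , label) pairs
-- focused  : Δ' , listed in the order in which formulas were focused

record Seq : Set where
  constructor seq
  field
    focused  : List Form
    labelled : List (Form × ℕ)
    ctx      : List Form
    area     : List ℕ
    goal     : Form

open Seq public

addArea : ℕ → List ℕ → List ℕ
addArea q ps with q ∈? ps
... | yes _ = ps
... | no  _ = ps ++ [ q ]

labelAll : ℕ → List Form → List (Form × ℕ)
labelAll q = map (λ γ → γ , q)

Axiom : Seq → Set
Axiom S = Σ ℕ λ q → goal S ≡ atom q × atom q ∈ focused S

Eligible : List (Form × ℕ) → ℕ → Form → Set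
Eligible used q γ = Σ Form λ α → Σ Form λ β → γ ≡ α ⇒ β × (γ , q) ∉ used

AllFocused : Seq → Set
AllFocused S = ∀ γ → γ ∈ ctx S → γ ∈ focused S

-- SDeriv chosen used S : strategy-generated proof of S, where
--   chosen = atoms already chosen for restart on this branch,
--   used   = →-left contexts (α→β , q) used since the last restart.

data SDeriv (chosen : List ℕ) (used : List (Form × ℕ)) : Seq → Set where
  ax : ∀ {S} → Axiom S → SDeriv chosen used S
  impR : ∀ {Δ' Υ Δ ps α β} →
    ¬ Axiom (seq Δ' Υ Δ ps (α ⇒ β)) →
    SDeriv chosen used (seq Δ' Υ (α ∷ Δ) ps β) →
    SDeriv chosen used (seq Δ' Υ Δ ps (α ⇒ β))
  focus : ∀ {Δ' Υ Δ ps q α} →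
    ¬ Axiom (seq Δ' Υ Δ ps (atom q)) →
    α ∈ Δ → α ∉ Δ' →
    SDeriv chosen used (seq (Δ' ++ [ α ]) Υ Δ ps (atom q)) →
    SDeriv chosen used (seq Δ' Υ Δ ps (atom q))
  impL : ∀ {xs ys Υ Δ ps q α β} →
    let Δ' = xs ++ (α ⇒ β) ∷ ys in
    ¬ Axiom (seq Δ' Υ Δ ps (atom q)) →
    AllFocused (seq Δ' Υ Δ ps (atom q)) →
    (α ⇒ β , q) ∉ used →
    All (λ γ → ¬ Eligible used q γ) xs →
    SDeriv chosen ((α ⇒ β , q) ∷ used)
      (seq Δ' (Υ ++ labelAll q Δ) Δ (addArea q ps) α) →
    SDeriv chosen ((α ⇒ β , q) ∷ used)
      (seq Δ' Υ (β ∷ Δ) ps (atom q)) →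
    SDeriv chosen used (seq Δ' Υ Δ ps (atom q))
  restart : ∀ {Δ' Υ Δ ls rs q p} →
    ¬ Axiom (seq Δ' Υ Δ (ls ++ p ∷ rs) (atom q)) →
    AllFocused (seq Δ' Υ Δ (ls ++ p ∷ rs) (atom q)) →
    All (λ γ → ¬ Eligible used q γ) Δ' →
    All (λ r → r ∈ chosen) ls →
    p ∉ chosen →
    let upto = ls ++ [ p ] in
    SDeriv (p ∷ chosen) []
      (seq []
           (filter (λ x → ¬? (proj₂ x ∈? upto)) Υ ++ labelAll q Δ)
           (map proj₁ (filter (λ x → proj₂ x ∈? upto) Υ))
           (addArea q (ls ++ p ∷ rs))
           (atom p)) →
    SDeriv chosen used (seq Δ' Υ Δ (ls ++ p ∷ rs) (atom q))

height : ∀ {ch us S} → SDeriv ch us S → ℕ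
height (ax _)                = 1
height (impR _ d)            = suc (height d)
height (focus _ _ _ d)       = suc (height d)
height (impL _ _ _ _ d₁ d₂)  = suc (height d₁ ⊔ height d₂)
height (restart _ _ _ _ _ d) = suc (height d)

root : Form → Seq
root α = seq [] [] [] [] α

-- Every sequent of a strategy proof of φ is built from subformulas and atoms of φ, so each
-- rule decreases, lexicographically, the tuple
--   (unchosen atoms of φ, unused →-left contexts (α→β , q), unfocused subformulas, size of the goal):
-- restart chooses a new atom, →-left uses a new context, focus focuses a new subformula and
-- →-right shrinks the goal, while the components to the right of the decreasing one are
-- reset to at most |φ|², |φ| and |φ|.  Weighting the components by |φ|³ + |φ| + 1, |φ|, 1, 1
-- makes the tuple a natural number that strictly decreases along every branch, so the height
-- is at most 1 + |φ|⁴ + |φ|³ + |φ|² + 3|φ| ≤ |φ|³ · 2^(|φ|+1) once |φ| ≥ 2.  An atom has no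
-- strategy proof at all.  The argument never uses that φ is a tautology.
module Submission where

open import Defs
open import Data.Nat using (ℕ; _*_; _+_; _^_; _≤_)
open import Data.List using ([])

open import Data.Nat using (zero; suc; _<_; z≤n; s≤s; _≟_)
open import Data.Nat.Properties
open import Data.Nat.Tactic.RingSolver using (solve-∀)
open import Data.List using (List; _∷_; _++_; [_]; map; filter; length; cartesianProduct)
open import Data.List.Properties using (length-++; length-map)
open import Data.List.Membership.Propositional using (_∈_; _∉_)
open import Data.List.Membership.Propositional.Properties
  using (∈-++⁺ˡ; ∈-++⁺ʳ; ∈-++⁻; ∈-map⁻; ∈-filter⁻; ∈-cartesianProductWith⁺)
open import Data.List.Membership.DecPropositional _≟_ using (_∈?_)
import Data.List.Membership.DecPropositional as DecMembership
open import Data.List.Relation.Binary.Subset.Propositional using (_⊆_)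
open import Data.List.Relation.Binary.Subset.Propositional.Properties using (xs⊆xs++ys)
open import Data.List.Relation.Unary.Any using (here; there)
open import Data.Product using (_×_; _,_; proj₁; proj₂)
open import Data.Product.Properties using (≡-dec)
open import Data.Sum using (inj₁; inj₂) renaming ([_,_] to either)
open import Data.Empty using (⊥-elim)
open import Function using (_∘_)
open import Relation.Nullary using (yes; no)
open import Relation.Nullary.Decidable using (¬?)
open import Relation.Binary.Definitions using (DecidableEquality)
open import Relation.Binary.PropositionalEquality using (_≡_; _≢_; refl; sym; trans; cong; cong₂)

_≟F_ : DecidableEquality Form
atom p ≟F atom q with p ≟ q
... | yes refl = yes refl
... | no p≢q   = no λ { refl → p≢q refl }
atom _ ≟F (_ ⇒ _) = no λ ()
(_ ⇒ _) ≟F atom _ = no λ ()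
(α ⇒ β) ≟F (γ ⇒ δ) with α ≟F γ | β ≟F δ
... | yes refl | yes refl = yes refl
... | no α≢γ   | _        = no λ { refl → α≢γ refl }
... | yes _    | no β≢δ   = no λ { refl → β≢δ refl }

module Missing {A : Set} (_≟ᴬ_ : DecidableEquality A) where
  open DecMembership _≟ᴬ_ using () renaming (_∈?_ to _∈?ᴬ_)

  missing : List A → List A → ℕ
  missing []      xs = 0
  missing (z ∷ L) xs with z ∈?ᴬ xs
  ... | yes _ = missing L xs
  ... | no  _ = suc (missing L xs)

  missing-≤-length : ∀ L xs → missing L xs ≤ length L
  missing-≤-length []      xs = z≤n
  missing-≤-length (z ∷ L) xs with z ∈?ᴬ xs
  ... | yes _ = m≤n⇒m≤1+n (missing-≤-length L xs)
  ... | no  _ = s≤s (missing-≤-length L xs)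

  missing-antitone : ∀ L {xs ys} → xs ⊆ ys → missing L ys ≤ missing L xs
  missing-antitone []      xs⊆ys = z≤n
  missing-antitone (z ∷ L) {xs} {ys} xs⊆ys with z ∈?ᴬ xs | z ∈?ᴬ ys
  ... | yes _    | yes _   = missing-antitone L xs⊆ys
  ... | yes z∈xs | no z∉ys = ⊥-elim (z∉ys (xs⊆ys z∈xs))
  ... | no _     | yes _   = m≤n⇒m≤1+n (missing-antitone L xs⊆ys)
  ... | no _     | no _    = s≤s (missing-antitone L xs⊆ys)

  missing-strict : ∀ L {xs ys p} → xs ⊆ ys → p ∈ L → p ∉ xs → p ∈ ys →
                   missing L ys < missing L xs
  missing-strict (z ∷ L) {xs} {ys} xs⊆ys (here refl) p∉xs p∈ys with z ∈?ᴬ xs | z ∈?ᴬ ys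
  ... | yes p∈xs | _       = ⊥-elim (p∉xs p∈xs)
  ... | no _     | yes _   = s≤s (missing-antitone L xs⊆ys)
  ... | no _     | no p∉ys = ⊥-elim (p∉ys p∈ys)
  missing-strict (z ∷ L) {xs} {ys} xs⊆ys (there p∈L) p∉xs p∈ys with z ∈?ᴬ xs | z ∈?ᴬ ys
  ... | yes _    | yes _   = missing-strict L xs⊆ys p∈L p∉xs p∈ys
  ... | yes z∈xs | no z∉ys = ⊥-elim (z∉ys (xs⊆ys z∈xs))
  ... | no _     | yes _   = m≤n⇒m≤1+n (missing-strict L xs⊆ys p∈L p∉xs p∈ys)
  ... | no _     | no _    = s≤s (missing-strict L xs⊆ys p∈L p∉xs p∈ys)

open Missing _≟F_ using ()
  renaming (missing to missingForms; missing-≤-length to missingForms-≤-length; missing-strict to missingForms-strict)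
open Missing (≡-dec _≟F_ _≟_) using ()
  renaming (missing to missingPairs; missing-≤-length to missingPairs-≤-length; missing-strict to missingPairs-strict)
open Missing _≟_ using ()
  renaming (missing to missingAtoms; missing-≤-length to missingAtoms-≤-length; missing-strict to missingAtoms-strict)

++-⊆ : ∀ {A : Set} {xs ys zs : List A} → xs ⊆ zs → ys ⊆ zs → xs ++ ys ⊆ zs
++-⊆ {xs = xs} xs⊆zs ys⊆zs = either xs⊆zs ys⊆zs ∘ ∈-++⁻ xs

length-cartesianProduct : ∀ {A B : Set} (xs : List A) (ys : List B) →
                          length (cartesianProduct xs ys) ≡ length xs * length ys
length-cartesianProduct []       ys = refl
length-cartesianProduct (x ∷ xs) ys = trans (length-++ (map (x ,_) ys))
  (cong₂ _+_ (length-map (x ,_) ys) (length-cartesianProduct xs ys))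

addArea-⊆ : ∀ q ps → addArea q ps ⊆ q ∷ ps
addArea-⊆ q ps r∈ with q ∈? ps
... | yes _ = there r∈
... | no  _ with ∈-++⁻ ps r∈
...   | inj₁ r∈ps         = there r∈ps
...   | inj₂ (here refl) = here refl

subformulas : Form → List Form
subformulas (atom p) = [ atom p ]
subformulas (α ⇒ β)  = (α ⇒ β) ∷ (subformulas α ++ subformulas β)

atoms : Form → List ℕ
atoms (atom p) = [ p ]
atoms (α ⇒ β)  = atoms α ++ atoms β

∈-subformulas-self : ∀ φ → φ ∈ subformulas φ
∈-subformulas-self (atom p) = here refl
∈-subformulas-self (α ⇒ β)  = here refl

subformulas-⊆ : ∀ φ {ψ} → ψ ∈ subformulas φ → subformulas ψ ⊆ subformulas φ
subformulas-⊆ (atom p) (here refl) = λ χ∈ → χ∈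
subformulas-⊆ (α ⇒ β)  (here refl) = λ χ∈ → χ∈
subformulas-⊆ (α ⇒ β)  (there ψ∈) with ∈-++⁻ (subformulas α) ψ∈
... | inj₁ ψ∈α = there ∘ ∈-++⁺ˡ ∘ subformulas-⊆ α ψ∈α
... | inj₂ ψ∈β = there ∘ ∈-++⁺ʳ (subformulas α) ∘ subformulas-⊆ β ψ∈β

⇒-subformulas : ∀ φ {α β} → (α ⇒ β) ∈ subformulas φ → α ∈ subformulas φ × β ∈ subformulas φ
⇒-subformulas φ {α} {β} ⇒∈ =
  subformulas-⊆ φ ⇒∈ (there (∈-++⁺ˡ (∈-subformulas-self α))) ,
  subformulas-⊆ φ ⇒∈ (there (∈-++⁺ʳ (subformulas α) (∈-subformulas-self β)))

atom∈subformulas⇒∈atoms : ∀ φ {q} → atom q ∈ subformulas φ → q ∈ atoms φ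
atom∈subformulas⇒∈atoms (atom p) (here refl) = here refl
atom∈subformulas⇒∈atoms (α ⇒ β)  (there q∈) with ∈-++⁻ (subformulas α) q∈
... | inj₁ q∈α = ∈-++⁺ˡ (atom∈subformulas⇒∈atoms α q∈α)
... | inj₂ q∈β = ∈-++⁺ʳ (atoms α) (atom∈subformulas⇒∈atoms β q∈β)

∈atoms⇒atom∈subformulas : ∀ φ {q} → q ∈ atoms φ → atom q ∈ subformulas φ
∈atoms⇒atom∈subformulas (atom p) (here refl) = here refl
∈atoms⇒atom∈subformulas (α ⇒ β)  q∈ with ∈-++⁻ (atoms α) q∈
... | inj₁ q∈α = there (∈-++⁺ˡ (∈atoms⇒atom∈subformulas α q∈α))
... | inj₂ q∈β = there (∈-++⁺ʳ (subformulas α) (∈atoms⇒atom∈subformulas β q∈β))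

size-subformula : ∀ φ {ψ} → ψ ∈ subformulas φ → size ψ ≤ size φ
size-subformula (atom p) (here refl) = ≤-refl
size-subformula (α ⇒ β)  (here refl) = ≤-refl
size-subformula (α ⇒ β)  (there ψ∈) with ∈-++⁻ (subformulas α) ψ∈
... | inj₁ ψ∈α = m≤n⇒m≤1+n (≤-trans (size-subformula α ψ∈α) (m≤m+n (size α) (size β)))
... | inj₂ ψ∈β = m≤n⇒m≤1+n (≤-trans (size-subformula β ψ∈β) (m≤n+m (size β) (size α)))

1≤size : ∀ φ → 1 ≤ size φ
1≤size (atom _) = ≤-refl
1≤size (_ ⇒ _)  = s≤s z≤n

length-subformulas : ∀ φ → length (subformulas φ) ≡ size φ
length-subformulas (atom p) = refl
length-subformulas (α ⇒ β)  = cong suc (trans (length-++ (subformulas α))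
  (cong₂ _+_ (length-subformulas α) (length-subformulas β)))

length-atoms : ∀ φ → length (atoms φ) ≤ size φ
length-atoms (atom p) = ≤-refl
length-atoms (α ⇒ β)  = m≤n⇒m≤1+n (≤-trans (≤-reflexive (length-++ (atoms α)))
  (+-mono-≤ (length-atoms α) (length-atoms β)))

weight : (N c u f g : ℕ) → ℕ
weight N c u f g = c * (N * N * N + N + 1) + u * N + f + g

weight-<-goal : ∀ N c u f {g g'} → g' < g → weight N c u f g' < weight N c u f g
weight-<-goal N c u f = +-monoʳ-< (c * (N * N * N + N + 1) + u * N + f)

weight-<-focused : ∀ N c u g {f f'} → f' < f → weight N c u f' g < weight N c u f g
weight-<-focused N c u g f'<f =
  +-monoˡ-< g (+-monoʳ-< (c * (N * N * N + N + 1) + u * N) f'<f)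

weight-<-used : ∀ N c f g {u u' g'} → u' < u → g' ≤ N →
                weight N c u' f g' < weight N c u f (suc g)
weight-<-used N c f g {u} {u'} {g'} u'<u g'≤N = begin-strict
  a + u' * N + f + g'    ≤⟨ +-monoʳ-≤ (a + u' * N + f) g'≤N ⟩
  a + u' * N + f + N    ≡⟨ shuffle a (u' * N) f N ⟩
  a + suc u' * N + f    ≤⟨ +-monoˡ-≤ f (+-monoʳ-≤ a (*-monoˡ-≤ N u'<u)) ⟩
  a + u * N + f         <⟨ m<m+n (a + u * N + f) (s≤s z≤n) ⟩
  a + u * N + f + suc g ∎
  where
  open ≤-Reasoning
  a : ℕ
  a = c * (N * N * N + N + 1)
  shuffle : ∀ a b f N → a + b + f + N ≡ a + (N + b) + f
  shuffle = solve-∀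

weight-<-chosen : ∀ N u g {c c' u' f f'} → c' < c → u' ≤ N * N → f' ≤ N →
                  weight N c' u' f' 1 < weight N c u f (suc g)
weight-<-chosen N u g {c} {c'} {u'} {f} {f'} c'<c u'≤N² f'≤N = begin-strict
  c' * X + u' * N + f' + 1      ≤⟨ +-monoˡ-≤ 1 (+-mono-≤ (+-monoʳ-≤ (c' * X) (*-monoˡ-≤ N u'≤N²)) f'≤N) ⟩
  c' * X + N * N * N + N + 1    ≡⟨ shuffle c' N ⟩
  suc c' * X                    ≤⟨ *-monoˡ-≤ X c'<c ⟩
  c * X                         ≤⟨ m≤m+n (c * X) (u * N + f) ⟩
  c * X + (u * N + f)           ≡⟨ sym (+-assoc (c * X) (u * N) f) ⟩
  c * X + u * N + f             <⟨ m<m+n (c * X + u * N + f) (s≤s z≤n) ⟩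
  c * X + u * N + f + suc g     ∎
  where
  open ≤-Reasoning
  X : ℕ
  X = N * N * N + N + 1
  shuffle : ∀ c N → c * (N * N * N + N + 1) + N * N * N + N + 1 ≡ suc c * (N * N * N + N + 1)
  shuffle = solve-∀

weight-mono : ∀ N {c c' u u' f f' g g'} → c ≤ c' → u ≤ u' → f ≤ f' → g ≤ g' →
              weight N c u f g ≤ weight N c' u' f' g'
weight-mono N c≤ u≤ f≤ g≤ =
  +-mono-≤ (+-mono-≤ (+-mono-≤ (*-monoˡ-≤ _ c≤) (*-monoˡ-≤ N u≤)) f≤) g≤

n<2^n : ∀ n → n < 2 ^ n
n<2^n zero    = s≤s z≤n
n<2^n (suc n) = begin-strict
  suc n         <⟨ s≤s (n<2^n n) ⟩
  suc (2 ^ n)   ≤⟨ +-monoˡ-≤ (2 ^ n) (m^n>0 2 n) ⟩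
  2 ^ n + 2 ^ n ≡⟨ cong (2 ^ n +_) (sym (+-identityʳ (2 ^ n))) ⟩
  2 ^ suc n     ∎
  where open ≤-Reasoning

weight-max-≤ : ∀ N → 2 ≤ N → suc (weight N N (N * N) N N) ≤ N * (2 ^ (N + 1) * (N * N))
weight-max-≤ N@(suc (suc m)) _ = begin
  suc (weight N N (N * N) N N)               ≤⟨ m≤m+n _ _ ⟩
  suc (weight N N (N * N) N N) + _           ≡⟨ expand m ⟩
  N * ((2 * (N + 1)) * (N * N))              ≤⟨ *-monoʳ-≤ N (*-monoˡ-≤ (N * N) 2[N+1]≤2^[N+1]) ⟩
  N * (2 ^ (N + 1) * (N * N))                ∎
  where
  open ≤-Reasoning
  expand : ∀ k → suc ((2 + k) * ((2 + k) * (2 + k) * (2 + k) + (2 + k) + 1)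
                       + (2 + k) * (2 + k) * (2 + k) + (2 + k) + (2 + k))
                 + (k * k * k * k + 9 * (k * k * k) + 29 * (k * k) + 37 * k + 13)
                 ≡ (2 + k) * ((2 * (2 + k + 1)) * ((2 + k) * (2 + k)))
  expand = solve-∀
  2[N+1]≤2^[N+1] : 2 * (N + 1) ≤ 2 ^ (N + 1)
  2[N+1]≤2^[N+1] = begin
    2 * (N + 1) ≡⟨ cong (2 *_) (+-comm N 1) ⟩
    2 * suc N   ≤⟨ *-monoʳ-≤ 2 (n<2^n N) ⟩
    2 ^ suc N   ≡⟨ cong (2 ^_) (+-comm 1 N) ⟩
    2 ^ (N + 1) ∎
weight-max-≤ (suc zero) (s≤s ())

module Measure (φ : Form) where
  N : ℕ
  N = size φ

  contexts : List (Form × ℕ)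
  contexts = cartesianProduct (subformulas φ) (atoms φ)

  record SubformulaClosed (S : Seq) : Set where
    field
      focused⊆  : focused S ⊆ subformulas φ
      labelled⊆ : ∀ {x} → x ∈ labelled S → proj₁ x ∈ subformulas φ
      ctx⊆      : ctx S ⊆ subformulas φ
      area⊆     : area S ⊆ atoms φ
      goal∈     : goal S ∈ subformulas φ
  open SubformulaClosed

  unchosen : List ℕ → ℕ
  unchosen = missingAtoms (atoms φ)

  unused : List (Form × ℕ) → ℕ
  unused = missingPairs contexts

  unfocused : List Form → ℕ
  unfocused = missingForms (subformulas φ)

  measure : List ℕ → List (Form × ℕ) → Seq → ℕ
  measure chosen used S = weight N (unchosen chosen) (unused used) (unfocused (focused S)) (size (goal S))

  unchosen-≤ : ∀ chosen → unchosen chosen ≤ N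
  unchosen-≤ chosen = ≤-trans (missingAtoms-≤-length (atoms φ) chosen) (length-atoms φ)

  unused-≤ : ∀ used → unused used ≤ N * N
  unused-≤ used = begin
    unused used                                ≤⟨ missingPairs-≤-length contexts used ⟩
    length contexts                            ≡⟨ length-cartesianProduct (subformulas φ) (atoms φ) ⟩
    length (subformulas φ) * length (atoms φ)  ≤⟨ *-mono-≤ (≤-reflexive (length-subformulas φ)) (length-atoms φ) ⟩
    N * N                                      ∎
    where open ≤-Reasoning

  unfocused-≤ : ∀ Δ' → unfocused Δ' ≤ N
  unfocused-≤ Δ' = ≤-trans (missingForms-≤-length (subformulas φ) Δ') (≤-reflexive (length-subformulas φ))

  labelAll-⊆ : ∀ {q Δ x} → Δ ⊆ subformulas φ → x ∈ labelAll q Δ → proj₁ x ∈ subformulas φ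
  labelAll-⊆ {q} Δ⊆ x∈ with ∈-map⁻ (λ γ → γ , q) x∈
  ... | γ , γ∈ , refl = Δ⊆ γ∈

  addArea-⊆-atoms : ∀ {q ps} → atom q ∈ subformulas φ → ps ⊆ atoms φ → addArea q ps ⊆ atoms φ
  addArea-⊆-atoms {q} {ps} q∈ ps⊆ r∈ with addArea-⊆ q ps r∈
  ... | here refl = atom∈subformulas⇒∈atoms φ q∈
  ... | there r∈ps = ps⊆ r∈ps

  height-≤-measure : ∀ {chosen used S} (d : SDeriv chosen used S) → SubformulaClosed S →
                     height d ≤ suc (measure chosen used S)
  height-≤-measure (ax _) _ = s≤s z≤n
  height-≤-measure {chosen} {used} (impR {Δ'} {Υ} {Δ} {ps} {α} {β} _ d) cl =
    s≤s (≤-trans (height-≤-measure d cl′)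
      (weight-<-goal N (unchosen chosen) (unused used) (unfocused Δ') (s≤s (m≤n+m (size β) (size α)))))
    where
    subs : α ∈ subformulas φ × β ∈ subformulas φ
    subs = ⇒-subformulas φ (goal∈ cl)
    cl′ : SubformulaClosed (seq Δ' Υ (α ∷ Δ) ps β)
    cl′ = record
      { focused⊆  = focused⊆ cl
      ; labelled⊆ = labelled⊆ cl
      ; ctx⊆      = λ { (here refl) → proj₁ subs ; (there γ∈) → ctx⊆ cl γ∈ }
      ; area⊆     = area⊆ cl
      ; goal∈     = proj₂ subs }
  height-≤-measure {chosen} {used} (focus {Δ'} {Υ} {Δ} {ps} {q} {α} _ α∈Δ α∉Δ' d) cl =
    s≤s (≤-trans (height-≤-measure d cl′) (weight-<-focused N (unchosen chosen) (unused used) 1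
      (missingForms-strict (subformulas φ) (xs⊆xs++ys Δ' [ α ]) (ctx⊆ cl α∈Δ) α∉Δ'
        (∈-++⁺ʳ Δ' (here refl)))))
    where
    cl′ : SubformulaClosed (seq (Δ' ++ [ α ]) Υ Δ ps (atom q))
    cl′ = record
      { focused⊆  = ++-⊆ (focused⊆ cl) λ { (here refl) → ctx⊆ cl α∈Δ }
      ; labelled⊆ = labelled⊆ cl
      ; ctx⊆      = ctx⊆ cl
      ; area⊆     = area⊆ cl
      ; goal∈     = goal∈ cl }
  height-≤-measure {chosen} {used} (impL {xs} {ys} {Υ} {Δ} {ps} {q} {α} {β} _ _ new _ d₁ d₂) cl =
    s≤s (⊔-lub
      (≤-trans (height-≤-measure d₁ cl₁) (weight-<-used N (unchosen chosen) f 0 fewer (size-subformula φ α∈)))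
      (≤-trans (height-≤-measure d₂ cl₂) (weight-<-used N (unchosen chosen) f 0 fewer (size-subformula φ (goal∈ cl)))))
    where
    f : ℕ
    f = unfocused (xs ++ (α ⇒ β) ∷ ys)
    ⇒∈ : (α ⇒ β) ∈ subformulas φ
    ⇒∈ = focused⊆ cl (∈-++⁺ʳ xs (here refl))
    α∈ : α ∈ subformulas φ
    α∈ = proj₁ (⇒-subformulas φ ⇒∈)
    fewer : unused ((α ⇒ β , q) ∷ used) < unused used
    fewer = missingPairs-strict contexts there
      (∈-cartesianProductWith⁺ _,_ ⇒∈ (atom∈subformulas⇒∈atoms φ (goal∈ cl))) new (here refl)
    cl₁ : SubformulaClosed (seq (xs ++ (α ⇒ β) ∷ ys) (Υ ++ labelAll q Δ) Δ (addArea q ps) α)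
    cl₁ = record
      { focused⊆  = focused⊆ cl
      ; labelled⊆ = either (labelled⊆ cl) (labelAll-⊆ (ctx⊆ cl)) ∘ ∈-++⁻ Υ
      ; ctx⊆      = ctx⊆ cl
      ; area⊆     = addArea-⊆-atoms (goal∈ cl) (area⊆ cl)
      ; goal∈     = α∈ }
    cl₂ : SubformulaClosed (seq (xs ++ (α ⇒ β) ∷ ys) Υ (β ∷ Δ) ps (atom q))
    cl₂ = record
      { focused⊆  = focused⊆ cl
      ; labelled⊆ = labelled⊆ cl
      ; ctx⊆      = λ { (here refl) → proj₂ (⇒-subformulas φ ⇒∈) ; (there γ∈) → ctx⊆ cl γ∈ }
      ; area⊆     = area⊆ cl
      ; goal∈     = goal∈ cl }
  height-≤-measure {chosen} {used} (restart {Δ'} {Υ} {Δ} {ls} {rs} {q} {p} _ _ _ _ p∉chosen d) cl =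
    s≤s (≤-trans (height-≤-measure d cl′) (weight-<-chosen N (unused used) 0 fewer
      (unused-≤ []) (unfocused-≤ [])))
    where
    upto : List ℕ
    upto = ls ++ [ p ]
    p∈ : p ∈ atoms φ
    p∈ = area⊆ cl (∈-++⁺ʳ ls (here refl))
    fewer : unchosen (p ∷ chosen) < unchosen chosen
    fewer = missingAtoms-strict (atoms φ) there p∈ p∉chosen (here refl)
    kept released : List (Form × ℕ)
    kept = filter (λ x → ¬? (proj₂ x ∈? upto)) Υ
    released = filter (λ x → proj₂ x ∈? upto) Υ
    released⊆ : map proj₁ released ⊆ subformulas φ
    released⊆ γ∈ with ∈-map⁻ proj₁ γ∈
    ... | x , x∈ , refl = labelled⊆ cl (proj₁ (∈-filter⁻ (λ x → proj₂ x ∈? upto) x∈))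
    cl′ : SubformulaClosed (seq [] (kept ++ labelAll q Δ) (map proj₁ released)
                                (addArea q (ls ++ p ∷ rs)) (atom p))
    cl′ = record
      { focused⊆  = λ ()
      ; labelled⊆ = either (labelled⊆ cl ∘ proj₁ ∘ ∈-filter⁻ (λ x → ¬? (proj₂ x ∈? upto)))
                           (labelAll-⊆ (ctx⊆ cl)) ∘ ∈-++⁻ kept
      ; ctx⊆      = released⊆
      ; area⊆     = addArea-⊆-atoms (goal∈ cl) (area⊆ cl)
      ; goal∈     = ∈atoms⇒atom∈subformulas φ p∈ }

  height-≤-measure-root : (d : SDeriv [] [] (root φ)) → height d ≤ suc (weight N N (N * N) N N)
  height-≤-measure-root d = ≤-trans (height-≤-measure d closed)
    (s≤s (weight-mono N (unchosen-≤ []) (unused-≤ []) (unfocused-≤ []) ≤-refl))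
    where
    closed : SubformulaClosed (root φ)
    closed = record { focused⊆ = λ () ; labelled⊆ = λ () ; ctx⊆ = λ () ; area⊆ = λ ()
                    ; goal∈ = ∈-subformulas-self φ }

++∷≢[] : ∀ {A : Set} (xs : List A) {y ys} → xs ++ y ∷ ys ≢ []
++∷≢[] []      ()
++∷≢[] (_ ∷ _) ()

stuck-underivable : ∀ {chosen used S p} → SDeriv chosen used S →
                    focused S ≡ [] → ctx S ≡ [] → area S ≡ [] → goal S ≢ atom p
stuck-underivable (ax (q , refl , q∈)) refl _ _ _ with q∈
... | ()
stuck-underivable (impR _ _) _ _ _ ()
stuck-underivable (focus _ () _ _) _ refl _ _
stuck-underivable (impL {xs} _ _ _ _ _ _) Δ'≡[] _ _ _ = ++∷≢[] xs Δ'≡[]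
stuck-underivable (restart {ls = ls} _ _ _ _ _ _) _ _ area≡[] _ = ++∷≢[] ls area≡[]

theorem2 : (α : Form) → Tautology α → (d : SDeriv [] [] (root α)) →
    height d ≤ size α * (2 ^ (size α + 1) * (size α * size α))
theorem2 (atom p) _ d = ⊥-elim (stuck-underivable d refl refl refl refl)
theorem2 (α ⇒ β)  _ d = ≤-trans (height-≤-measure-root d) (weight-max-≤ (size (α ⇒ β)) 2≤N)
  where
  open Measure (α ⇒ β)
  2≤N : 2 ≤ size (α ⇒ β)
  2≤N = s≤s (≤-trans (1≤size α) (m≤m+n (size α) (size β)))
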